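{- Let $n$ be even, let $c>1$ be a constant and $n+2\le m\le cn$, and let $\mathbf{H}=\mathbf{H}(n,m)$ be the random balanced graph. If $H$ is a graph with $\mathbb{P}(\mathbf{H}=H)>0$, then $H$ is strictly balanced.
   Context: Random balanced graph: let $n$ be even and write $m=q\cdot\frac n2+r$ with integers $q\ge 2$, $0\le r<\frac n2$. For a cycle $C=(v_1,v_2,\dots,v_n,v_1)$ of order $n$ and $0\le r\le n$, let $R(C,r)=\{v_i:1\le i\le n,\ \lfloor (i-1)r/n\rfloor<\lfloor ir/n\rfloor\}$ (a set of $r$ almost equidistributed vertices of $C$). The random multigraph $\mathbf{H}^*=\mathbf{H}^*(n,m)$ is the multigraph sum $\mathbf{H}_r+\mathbf{H}_h+\mathbf{H}_b$ on $[n]$ (edge multisets added with multiplicities), where: $\mathbf{H}_r$ is a uniformly random $(q-2)$-regular simple graph on $[n]$; $\mathbf{H}_h$ is a uniformly random Hamilton cycle on $[n]$, independent of $\mathbf{H}_r$; with $\mathbf{R}=R(\mathbf{H}_h,r)$, for every $x\in\mathbf{R}$ a vertex $\mathbf{y}[x]\in[n]$ is chosen so that the $r$ vertices $(\mathbf{y}[x])_{x\in\mathbf{R}}$ are independent of $\mathbf{H}_r,\mathbf{H}_h$ and uniformly distributed over all sequences of $r$ distinct vertices, and $\mathbf{H}_b$ has edge multiset $\{\{x,\mathbf{y}[x]\}:x\in\mathbf{R}\}$ (loops and double edges allowed). The random balanced graph $\mathbf{H}(n,m)$ has the distribution of $\mathbf{H}^*(n,m)$ conditioned on being a simple graph. A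 graph $H$ is strictly balanced if $e(H)/v(H)>e(H_0)/v(H_0)$ for every proper subgraph $H_0$. -}

module Defs where

open import Data.Nat using (ℕ; zero; suc; _+_; _*_; _∸_; _≤_; _<_; _<ᵇ_)
open import Data.Nat.DivMod using (_/_)
import Data.Nat.Properties as ℕP
open import Data.Fin using (Fin; toℕ; lower₁) renaming (zero to fzero; suc to fsuc)
import Data.Fin as F
open import Data.Fin.Permutation using (Permutation′; _⟨$⟩ʳ_)
open import Data.Bool using (Bool; true; false; _∧_; _∨_; if_then_else_)
open import Data.List using (List; []; _∷_; map; filter; concatMap; _++_; allFin; foldr)
open import Data.Product using (Σ; _×_; _,_; proj₁; proj₂; ∃-syntax)
open import Data.Sum using (_⊎_)
open import Relation.Nullary using (¬_; yes; no)
open import Relation.Nullary.Decidable using (⌊_⌋)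
open import Relation.Binary.PropositionalEquality using (_≡_; refl; cong)

countTrue : List Bool → ℕ
countTrue = foldr (λ b k → if b then suc k else k) 0

allPairs : (n : ℕ) → List (Fin n × Fin n)
allPairs n = concatMap (λ i → map (λ j → (i , j)) (allFin n)) (allFin n)

record Graph (n : ℕ) : Set where
  field
    adj  : Fin n → Fin n → Bool
    symm : ∀ i j → adj i j ≡ adj j i
    irr  : ∀ i → adj i i ≡ false
open Graph public

eCount : ∀ {n} → (Fin n → Fin n → Bool) → ℕ
eCount {n} E = countTrue (map (λ p → (toℕ (proj₁ p) <ᵇ toℕ (proj₂ p)) ∧ E (proj₁ p) (proj₂ p)) (allPairs n))

degree : ∀ {n} → Graph n → Fin n → ℕ
degree {n} G i = countTrue (map (adj G i) (allFin n))

record Subgraph {n : ℕ} (H : Graph n) : Set where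
  field
    V      : Fin n → Bool
    E      : Fin n → Fin n → Bool
    Esymm  : ∀ i j → E i j ≡ E j i
    E⊆H    : ∀ i j → E i j ≡ true → adj H i j ≡ true
    E⊆V    : ∀ i j → E i j ≡ true → V i ≡ true
open Subgraph public

vCountS : ∀ {n} {H : Graph n} → Subgraph H → ℕ
vCountS {n} S = countTrue (map (V S) (allFin n))

eCountS : ∀ {n} {H : Graph n} → Subgraph H → ℕ
eCountS S = eCount (E S)

Proper : ∀ {n} {H : Graph n} → Subgraph H → Set
Proper {n} {H} S =
  (Σ (Fin n) λ i → V S i ≡ false) ⊎
  (Σ (Fin n) λ i → Σ (Fin n) λ j → adj H i j ≡ true × E S i j ≡ false)

-- e(H)/v(H) > e(H₀)/v(H₀) for every proper subgraph H₀ (with v(H₀) ≥ 1,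
-- so that the ratio is defined), cross-multiplied; v(H) = n.
StrictlyBalanced : ∀ {n} → Graph n → Set
StrictlyBalanced {n} H =
  (S : Subgraph H) → Proper S → 1 ≤ vCountS S →
  eCountS S * n < eCount (adj H) * vCountS S

-- Multigraphs as lists of edges (ordered pairs read as unordered edges)

Multigraph : ℕ → Set
Multigraph n = List (Fin n × Fin n)

mult : ∀ {n} → Multigraph n → Fin n → Fin n → ℕ
mult L a b = countTrue (map (λ e →
  (⌊ proj₁ e F.≟ a ⌋ ∧ ⌊ proj₂ e F.≟ b ⌋) ∨ (⌊ proj₁ e F.≟ b ⌋ ∧ ⌊ proj₂ e F.≟ a ⌋)) L)

edgesOf : ∀ {n} → Graph n → Multigraph n
edgesOf {n} G = filter (λ p → (toℕ (proj₁ p) ℕP.<? toℕ (proj₂ p))) (filterAdj (allPairs n))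
  where
    filterAdj : Multigraph n → Multigraph n
    filterAdj = filter (λ p → adj G (proj₁ p) (proj₂ p) Data.Bool.≟ true)
      where import Data.Bool

-- Hamilton cycle (v₁,…,vₙ,v₁) given by a permutation σ, vᵢ = σ(i-1)

next : ∀ {n} → Fin n → Fin n
next {suc k} i with toℕ i ℕP.≟ k
... | yes _ = fzero
... | no ne = lower₁ (fsuc i) (λ eq → ne (ℕP.suc-injective (Relation.Binary.PropositionalEquality.sym eq)))
  where import Relation.Binary.PropositionalEquality

cycleEdges : ∀ {n} → Permutation′ n → Multigraph n
cycleEdges {n} σ = map (λ k → (σ ⟨$⟩ʳ k , σ ⟨$⟩ʳ next k)) (allFin n)

-- position k (0-based, i = k+1) belongs to R(C,r) iff ⌊k r/n⌋ < ⌊(k+1) r/n⌋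
inR : ∀ {n} → ℕ → Fin n → Bool
inR {suc n'} r k = ((toℕ k * r) / suc n') <ᵇ ((suc (toℕ k) * r) / suc n')

-- the edges {x, y[x]} for x = v_{k+1} ∈ R; y is indexed by cycle positions
bridgeEdges : ∀ {n} → ℕ → Permutation′ n → (Fin n → Fin n) → Multigraph n
bridgeEdges {n} r σ y =
  map (λ k → (σ ⟨$⟩ʳ k , y k)) (filter (λ k → inR r k Data.Bool.≟ true) (allFin n))
  where import Data.Bool

-- Support of the random balanced graph H(n,m), n = 2h, m = q h + r:
-- H has positive probability iff H = H_r + H_h + H_b for some outcome
-- (H_r (q-2)-regular simple, H_h a Hamilton cycle, y injective on R).

InSupport : (h q r : ℕ) → Graph (2 * h) → Set
InSupport h q r H =
  Σ (Graph (2 * h)) λ Hr →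
  Σ (Permutation′ (2 * h)) λ σ →
  Σ (Fin (2 * h) → Fin (2 * h)) λ y →
    (∀ v → degree Hr v ≡ q ∸ 2) ×
    (∀ k l → inR r k ≡ true → inR r l ≡ true → y k ≡ y l → k ≡ l) ×
    (∀ a b → mult (edgesOf Hr ++ cycleEdges σ ++ bridgeEdges r σ y) a b
               ≡ (if adj H a b then 1 else 0))

{-# OPTIONS --safe #-}
module Submission where

-- H is the simple sum of a d-regular graph (d = q − 2), a Hamilton cycle C on N = 2h vertices and r
-- bridges, one at each point of R(C,r), so e(H) = dN/2 + N + r. A proper subgraph H₀ spanning all
-- N vertices misses an edge; otherwise its vertex set W, of size v ≥ 1, is proper. H₀ has at most
-- dv/2 edges of the regular part, plus at most C + B others, where C counts the cycle edges inside W
-- and B the points of R in W. W cuts the cycle into v − C ≥ 1 arcs, and since R marks the positions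
-- k where ⌊kr/N⌋ jumps, an arc of length ℓ holds fewer than ℓr/N + 1 of them. So B < vr/N + v − C,
-- that is N(C + B) < (N + r)v, and e(H₀)/v < d/2 + 1 + r/N = e(H)/N.

open import Defs
open import Data.Nat using (ℕ; zero; suc; _+_; _*_; _∸_; _≤_; _<_; _≮_; _<ᵇ_; z≤n; s≤s; s≤s⁻¹; NonZero)
open import Data.Nat.Properties
open import Data.Nat.DivMod
open import Data.Nat.ListAction using (sum)
open import Data.Nat.ListAction.Properties using (sum-++)
open import Data.Nat.Tactic.RingSolver using (solve-∀)
open import Data.Bool using (Bool; true; false; if_then_else_; _∧_; _∨_; not; T)
open import Data.Bool.Properties using (T-≡; ¬-not)
open import Function.Bundles using (Equivalence)
open import Data.Product using (_×_; _,_; proj₁; proj₂; ∃-syntax)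
open import Data.Sum using (_⊎_; inj₁; inj₂)
open import Data.List using (List; []; _∷_; map; filter; concatMap; _++_; allFin; tabulate)
open import Data.List.Properties using (map-cong; map-∘; map-++)
open import Data.List.Membership.Propositional using (_∈_)
open import Data.List.Membership.Propositional.Properties using (∈-allFin)
open import Data.List.Relation.Unary.Any using (here; there)
open import Data.Fin using (Fin; toℕ; fromℕ; fromℕ<; inject₁) renaming (zero to fzero; suc to fsuc)
import Data.Fin as F
import Data.Fin.Properties as FinP
import Data.Bool
open import Data.Fin.Permutation using (Permutation′; _⟨$⟩ʳ_; _⟨$⟩ˡ_; inverseʳ)
open import Relation.Nullary using (Dec; does; yes; no; contradiction)
open import Relation.Nullary.Decidable using (⌊_⌋; isYes≗does; dec-true)
open import Relation.Unary using (Pred; Decidable)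
open import Relation.Binary.PropositionalEquality
open import Relation.Binary using (tri<; tri≈; tri>)
open import Function using (_∘_; id)
import Algebra.Properties.CommutativeMonoid.Sum +-0-commutativeMonoid as Vector

⟦_⟧ : Bool → ℕ
⟦ b ⟧ = if b then 1 else 0

∑ : {A : Set} → List A → (A → ℕ) → ℕ
∑ xs f = sum (map f xs)

syntax ∑ xs (λ x → e) = ∑[ x ∈ xs ] e

module _ {A : Set} where

  countTrue-map : (p : A → Bool) (xs : List A) → countTrue (map p xs) ≡ ∑[ x ∈ xs ] ⟦ p x ⟧
  countTrue-map p [] = refl
  countTrue-map p (x ∷ xs) with p x
  ... | true  = cong suc (countTrue-map p xs)
  ... | false = countTrue-map p xs

  ∑-cong : {f g : A → ℕ} (xs : List A) → (∀ x → f x ≡ g x) → ∑ xs f ≡ ∑ xs g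
  ∑-cong xs f≗g = cong sum (map-cong f≗g xs)

  ∑-cong-∈ : {f g : A → ℕ} (xs : List A) → (∀ {x} → x ∈ xs → f x ≡ g x) → ∑ xs f ≡ ∑ xs g
  ∑-cong-∈ []       eq = refl
  ∑-cong-∈ (x ∷ xs) eq = cong₂ _+_ (eq (here refl)) (∑-cong-∈ xs (eq ∘ there))

  ∑-mono-≤ : {f g : A → ℕ} (xs : List A) → (∀ x → f x ≤ g x) → ∑ xs f ≤ ∑ xs g
  ∑-mono-≤ []       f≤g = z≤n
  ∑-mono-≤ (x ∷ xs) f≤g = +-mono-≤ (f≤g x) (∑-mono-≤ xs f≤g)

  ∑-mono-< : {f g : A → ℕ} {x : A} (xs : List A) → x ∈ xs →
             (∀ x → f x ≤ g x) → f x < g x → ∑ xs f < ∑ xs g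
  ∑-mono-< (y ∷ xs) (here refl) f≤g fx<gx = +-mono-<-≤ fx<gx (∑-mono-≤ xs f≤g)
  ∑-mono-< (y ∷ xs) (there x∈) f≤g fx<gx = +-mono-≤-< (f≤g y) (∑-mono-< xs x∈ f≤g fx<gx)

  ∈⇒≤∑ : (f : A → ℕ) {x : A} {xs : List A} → x ∈ xs → f x ≤ ∑ xs f
  ∈⇒≤∑ f (here refl) = m≤m+n _ _
  ∈⇒≤∑ f {xs = y ∷ _} (there x∈) = ≤-trans (∈⇒≤∑ f x∈) (m≤n+m _ (f y))

  ∑≡0⇒≡0 : (f : A → ℕ) {x : A} {xs : List A} → ∑ xs f ≡ 0 → x ∈ xs → f x ≡ 0
  ∑≡0⇒≡0 f ∑≡0 x∈ = n≤0⇒n≡0 (subst (f _ ≤_) ∑≡0 (∈⇒≤∑ f x∈))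

  1≤∑⟦⟧⇒∃ : (p : A → Bool) (xs : List A) → 1 ≤ ∑[ x ∈ xs ] ⟦ p x ⟧ → ∃[ x ] p x ≡ true
  1≤∑⟦⟧⇒∃ p (x ∷ xs) pos with p x in eq
  ... | true  = x , eq
  ... | false = 1≤∑⟦⟧⇒∃ p xs pos

  ∑-zero : (xs : List A) → ∑[ x ∈ xs ] 0 ≡ 0
  ∑-zero []       = refl
  ∑-zero (x ∷ xs) = ∑-zero xs

  ∑-distrib-+ : (f g : A → ℕ) (xs : List A) → ∑[ x ∈ xs ] (f x + g x) ≡ ∑ xs f + ∑ xs g
  ∑-distrib-+ f g []       = refl
  ∑-distrib-+ f g (x ∷ xs) rewrite ∑-distrib-+ f g xs = +-interchange (f x) (g x) (∑ xs f) (∑ xs g)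
    where
    +-interchange : ∀ a b c d → (a + b) + (c + d) ≡ (a + c) + (b + d)
    +-interchange = solve-∀

  *-distribˡ-∑ : (c : ℕ) (f : A → ℕ) (xs : List A) → c * ∑ xs f ≡ ∑[ x ∈ xs ] (c * f x)
  *-distribˡ-∑ c f []       = *-zeroʳ c
  *-distribˡ-∑ c f (x ∷ xs) = trans (*-distribˡ-+ c (f x) (∑ xs f)) (cong (c * f x +_) (*-distribˡ-∑ c f xs))

  *-distribʳ-∑ : (c : ℕ) (f : A → ℕ) (xs : List A) → ∑ xs f * c ≡ ∑[ x ∈ xs ] (f x * c)
  *-distribʳ-∑ c f xs = trans (*-comm (∑ xs f) c) (trans (*-distribˡ-∑ c f xs) (∑-cong xs (λ x → *-comm c (f x))))

  ∑-++ : (f : A → ℕ) (xs ys : List A) → ∑ (xs ++ ys) f ≡ ∑ xs f + ∑ ys f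
  ∑-++ f xs ys = trans (cong sum (map-++ f xs ys)) (sum-++ (map f xs) (map f ys))

  ∑-filter : ∀ {ℓ} {P : Pred A ℓ} (P? : Decidable P) (f : A → ℕ) (xs : List A) →
             ∑ (filter P? xs) f ≡ ∑[ x ∈ xs ] (⟦ does (P? x) ⟧ * f x)
  ∑-filter P? f []       = refl
  ∑-filter P? f (x ∷ xs) with does (P? x)
  ... | true  = cong₂ _+_ (sym (+-identityʳ (f x))) (∑-filter P? f xs)
  ... | false = ∑-filter P? f xs

  ∑-distrib-+₃ : (f g h : A → ℕ) (xs : List A) → ∑[ x ∈ xs ] (f x + g x + h x) ≡ ∑ xs f + ∑ xs g + ∑ xs h
  ∑-distrib-+₃ f g h xs = trans (∑-distrib-+ (λ x → f x + g x) h xs) (cong (_+ ∑ xs h) (∑-distrib-+ f g xs))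

module _ {A B : Set} where

  ∑-map : (g : A → B) (f : B → ℕ) (xs : List A) → ∑ (map g xs) f ≡ ∑ xs (f ∘ g)
  ∑-map g f xs = cong sum (sym (map-∘ xs))

  ∑-concatMap : (g : A → List B) (f : B → ℕ) (xs : List A) →
                ∑ (concatMap g xs) f ≡ ∑[ x ∈ xs ] ∑ (g x) f
  ∑-concatMap g f []       = refl
  ∑-concatMap g f (x ∷ xs) = trans (∑-++ f (g x) (concatMap g xs)) (cong (∑ (g x) f +_) (∑-concatMap g f xs))

  ∑-comm : (f : A → B → ℕ) (xs : List A) (ys : List B) →
           ∑[ x ∈ xs ] ∑ ys (f x) ≡ ∑[ y ∈ ys ] ∑[ x ∈ xs ] f x y
  ∑-comm f []       ys = sym (∑-zero ys)
  ∑-comm f (x ∷ xs) ys = trans (cong (∑ ys (f x) +_) (∑-comm f xs ys)) (sym (∑-distrib-+ (f x) _ ys))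

∑-tabulate : ∀ {A : Set} {n} (g : Fin n → A) (f : A → ℕ) → ∑ (tabulate g) f ≡ Vector.sum (f ∘ g)
∑-tabulate {n = zero}  g f = refl
∑-tabulate {n = suc n} g f = cong (f (g fzero) +_) (∑-tabulate (g ∘ fsuc) f)

∑-allFin-const : ∀ n (c : ℕ) → ∑[ a ∈ allFin n ] c ≡ n * c
∑-allFin-const n c = trans (∑-tabulate {n = n} id (λ _ → c)) (vector-const n)
  where
  vector-const : ∀ n → Vector.sum {n} (λ _ → c) ≡ n * c
  vector-const zero    = refl
  vector-const (suc n) = cong (c +_) (vector-const n)

∑-permute : ∀ {n} (f : Fin n → ℕ) (σ : Permutation′ n) → ∑[ k ∈ allFin n ] f (σ ⟨$⟩ʳ k) ≡ ∑ (allFin n) f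
∑-permute {n} f σ = begin
  ∑[ k ∈ allFin n ] f (σ ⟨$⟩ʳ k)  ≡⟨ ∑-tabulate id (λ k → f (σ ⟨$⟩ʳ k)) ⟩
  Vector.sum (λ k → f (σ ⟨$⟩ʳ k))    ≡⟨ Vector.∑-permute f σ ⟨
  Vector.sum f                       ≡⟨ ∑-tabulate id f ⟨
  ∑ (allFin n) f                  ∎
  where open ≡-Reasoning

⌊suc≟suc⌋ : ∀ {n} (x y : Fin n) → ⌊ fsuc x F.≟ fsuc y ⌋ ≡ ⌊ x F.≟ y ⌋
⌊suc≟suc⌋ x y with x F.≟ y
... | yes _ = refl
... | no _  = refl

∑-δ : ∀ {n} (x : Fin n) (f : Fin n → ℕ) → ∑[ a ∈ allFin n ] (⟦ ⌊ x F.≟ a ⌋ ⟧ * f a) ≡ f x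
∑-δ x f = trans (∑-tabulate id (λ a → ⟦ ⌊ x F.≟ a ⌋ ⟧ * f a)) (vector-δ x f)
  where
  vector-δ : ∀ {n} (x : Fin n) (f : Fin n → ℕ) → Vector.sum (λ a → ⟦ ⌊ x F.≟ a ⌋ ⟧ * f a) ≡ f x
  vector-δ {suc n} fzero    f = trans (cong₂ _+_ (*-identityˡ (f fzero)) (Vector.sum-replicate-zero n)) (+-identityʳ (f fzero))
  vector-δ {suc n} (fsuc x) f = trans (Vector.sum-cong-≗ (λ a → cong (λ b → ⟦ b ⟧ * f (fsuc a)) (⌊suc≟suc⌋ x a))) (vector-δ x (f ∘ fsuc))

toℕ-next : ∀ {n} (i : Fin (suc n)) → toℕ (next i) ≡ suc (toℕ i) % suc n
toℕ-next {n} i with toℕ i ≟ n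
... | yes i≡n = trans (sym (n%n≡0 (suc n))) (cong (λ m → suc m % suc n) (sym i≡n))
... | no i≢n  = trans (FinP.toℕ-lower₁ (fsuc i) (i≢n ∘ suc-injective ∘ sym))
                      (sym (m<n⇒m%n≡m (s≤s (≤∧≢⇒< (s≤s⁻¹ (FinP.toℕ<n i)) i≢n))))

next-inject₁ : ∀ {n} (i : Fin n) → next (inject₁ i) ≡ fsuc i
next-inject₁ {n} i = FinP.toℕ-injective (begin
  toℕ (next (inject₁ i))        ≡⟨ toℕ-next (inject₁ i) ⟩
  suc (toℕ (inject₁ i)) % suc n ≡⟨ cong (λ m → suc m % suc n) (FinP.toℕ-inject₁ i) ⟩
  suc (toℕ i) % suc n           ≡⟨ m<n⇒m%n≡m (s≤s (FinP.toℕ<n i)) ⟩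
  suc (toℕ i)                   ∎)
  where open ≡-Reasoning

next-fromℕ : ∀ n → next (fromℕ n) ≡ fzero
next-fromℕ n = FinP.toℕ-injective (trans (toℕ-next (fromℕ n))
  (trans (cong (λ m → suc m % suc n) (FinP.toℕ-fromℕ n)) (n%n≡0 (suc n))))

∑-next : ∀ {n} (f : Fin (suc n) → ℕ) → ∑[ k ∈ allFin (suc n) ] f (next k) ≡ ∑ (allFin (suc n)) f
∑-next {n} f = begin
  ∑[ k ∈ allFin (suc n) ] f (next k)                ≡⟨ ∑-tabulate id (f ∘ next) ⟩
  Vector.sum (f ∘ next)                                ≡⟨ Vector.sum-init-last (f ∘ next) ⟩
  Vector.sum (f ∘ next ∘ inject₁) + f (next (fromℕ n)) ≡⟨ cong₂ _+_ (Vector.sum-cong-≗ (cong f ∘ next-inject₁)) (cong f (next-fromℕ n)) ⟩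
  Vector.sum (f ∘ fsuc) + f fzero                      ≡⟨ +-comm _ (f fzero) ⟩
  Vector.sum f                                         ≡⟨ ∑-tabulate id f ⟨
  ∑ (allFin (suc n)) f                              ∎
  where open ≡-Reasoning

next-induction : ∀ {n ℓ} (P : Fin (suc n) → Set ℓ) → P fzero → (∀ k → P k → P (next k)) → ∀ k → P k
next-induction {n} P P0 step k = subst P (FinP.fromℕ<-toℕ k (FinP.toℕ<n k)) (reach (toℕ k) (FinP.toℕ<n k))
  where
  reach : ∀ m (m<N : m < suc n) → P (fromℕ< m<N)
  reach zero    _     = P0
  reach (suc m) m+1<N = subst P (FinP.toℕ-injective toℕ-eq) (step _ (reach m m<N))
    where
    m<N : m < suc n
    m<N = <-trans (n<1+n m) m+1<N
    toℕ-eq : toℕ (next (fromℕ< m<N)) ≡ toℕ (fromℕ< m+1<N)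
    toℕ-eq = begin
      toℕ (next (fromℕ< m<N))         ≡⟨ toℕ-next (fromℕ< m<N) ⟩
      suc (toℕ (fromℕ< m<N)) % suc n  ≡⟨ cong (λ j → suc j % suc n) (FinP.toℕ-fromℕ< m<N) ⟩
      suc m % suc n                   ≡⟨ m<n⇒m%n≡m m+1<N ⟩
      suc m                           ≡⟨ FinP.toℕ-fromℕ< m+1<N ⟨
      toℕ (fromℕ< m+1<N)              ∎
      where open ≡-Reasoning

<ᵇ-true : ∀ {m n} → m < n → (m <ᵇ n) ≡ true
<ᵇ-true m<n = Equivalence.to T-≡ (<⇒<ᵇ m<n)

<ᵇ-false : ∀ {m n} → m ≮ n → (m <ᵇ n) ≡ false
<ᵇ-false {m} {n} m≮n with m <ᵇ n in eq
... | false = refl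
... | true  = contradiction (<ᵇ⇒< m n (subst T (sym eq) _)) m≮n

/-%-unique : ∀ {x s a} N .{{_ : NonZero N}} → x ≡ s + a * N → s < N → x / N ≡ a × x % N ≡ s
/-%-unique {x} {s} {a} N x≡s+aN s<N = x/N≡a , x%N≡s
  where
  x%N≡s : x % N ≡ s
  x%N≡s = trans (cong (_% N) x≡s+aN) (trans ([m+kn]%n≡m%n s a N) (m<n⇒m%n≡m s<N))
  x/N≡a : x / N ≡ a
  x/N≡a = *-cancelʳ-≡ (x / N) a N (+-cancelˡ-≡ s _ _
            (trans (cong (_+ x / N * N) (sym x%N≡s)) (trans (sym (m≡m%n+[m/n]*n x N)) x≡s+aN)))

r+m≡[m%n+r]+[m/n]*n : ∀ r m n .{{_ : NonZero n}} → r + m ≡ (m % n + r) + m / n * n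
r+m≡[m%n+r]+[m/n]*n r m n = trans (cong (r +_) (m≡m%n+[m/n]*n m n)) (rearrange r (m % n) (m / n * n))
  where
  rearrange : ∀ a b c → a + (b + c) ≡ (b + a) + c
  rearrange = solve-∀

/-%-step : ∀ N .{{_ : NonZero N}} {r} x → r ≤ N →
           N * ⟦ x / N <ᵇ (r + x) / N ⟧ + (r + x) % N ≡ r + x % N
/-%-step N {r} x r≤N with x % N + r <? N
... | yes s<N = no-carry (/-%-unique N (r+m≡[m%n+r]+[m/n]*n r x N) s<N)
  where
  no-carry : (r + x) / N ≡ x / N × (r + x) % N ≡ x % N + r →
             N * ⟦ x / N <ᵇ (r + x) / N ⟧ + (r + x) % N ≡ r + x % N
  no-carry (q≡ , s≡) rewrite q≡ | s≡ | <ᵇ-false (n≮n (x / N)) =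
    trans (cong (_+ (x % N + r)) (*-zeroʳ N)) (+-comm (x % N) r)
... | no s≮N = carry (/-%-unique N r+x≡ s∸N<N)
  where
  N≤s : N ≤ x % N + r
  N≤s = ≮⇒≥ s≮N
  s∸N<N : x % N + r ∸ N < N
  s∸N<N = +-cancelʳ-< N _ N (subst (_< N + N) (sym (m∸n+n≡m N≤s)) (+-mono-<-≤ (m%n<n x N) r≤N))
  r+x≡ : r + x ≡ (x % N + r ∸ N) + suc (x / N) * N
  r+x≡ = begin
    r + x                                  ≡⟨ r+m≡[m%n+r]+[m/n]*n r x N ⟩
    (x % N + r) + x / N * N                ≡⟨ cong (_+ x / N * N) (m∸n+n≡m N≤s) ⟨
    (x % N + r ∸ N) + N + x / N * N        ≡⟨ +-assoc (x % N + r ∸ N) N (x / N * N) ⟩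
    (x % N + r ∸ N) + suc (x / N) * N      ∎
    where open ≡-Reasoning
  carry : (r + x) / N ≡ suc (x / N) × (r + x) % N ≡ x % N + r ∸ N →
          N * ⟦ x / N <ᵇ (r + x) / N ⟧ + (r + x) % N ≡ r + x % N
  carry (q≡ , s≡) rewrite q≡ | s≡ | <ᵇ-true (n<1+n (x / N)) =
    trans (cong (_+ (x % N + r ∸ N)) (*-identityʳ N)) (trans (m+[n∸m]≡n N≤s) (+-comm (x % N) r))

[m%n]*o%n≡m*o%n : ∀ m n o .{{_ : NonZero n}} → (m % n * o) % n ≡ (m * o) % n
[m%n]*o%n≡m*o%n m n o = begin
  (m % n * o) % n            ≡⟨ %-distribˡ-* (m % n) o n ⟩
  (m % n % n * (o % n)) % n  ≡⟨ cong (λ a → (a * (o % n)) % n) (m%n%n≡m%n m n) ⟩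
  (m % n * (o % n)) % n      ≡⟨ %-distribˡ-* m o n ⟨
  (m * o) % n                ∎
  where open ≡-Reasoning

module _ {n : ℕ} (r : ℕ) where

  -- R(C,r) marks the positions k where ⌊kr/N⌋ jumps; kr mod N is the matching potential for Arcs.
  offset : Fin (suc n) → ℕ
  offset k = toℕ k * r % suc n

  inR-balance : r ≤ suc n → ∀ k → suc n * ⟦ inR r k ⟧ + offset (next k) ≡ r + offset k
  inR-balance r≤N k = trans (cong (suc n * ⟦ inR r k ⟧ +_) offset-next) (/-%-step (suc n) (toℕ k * r) r≤N)
    where
    offset-next : offset (next k) ≡ (r + toℕ k * r) % suc n
    offset-next = trans (cong (λ m → m * r % suc n) (toℕ-next k)) ([m%n]*o%n≡m*o%n (suc (toℕ k)) (suc n) r)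

split-exit : ∀ p q → ⟦ p ⟧ ≡ ⟦ p ⟧ * ⟦ q ⟧ + ⟦ p ∧ not q ⟧
split-exit true  true  = refl
split-exit true  false = refl
split-exit false q     = refl

split-entry : ∀ p q → ⟦ q ⟧ ≡ ⟦ p ⟧ * ⟦ q ⟧ + ⟦ not p ∧ q ⟧
split-entry true  true  = refl
split-entry true  false = refl
split-entry false true  = refl
split-entry false false = refl

no-exit-no-entry : ∀ p q → ⟦ p ∧ not q ⟧ ≡ 0 → ⟦ not p ∧ q ⟧ ≡ 0 → q ≡ p
no-exit-no-entry true  true  _ _ = refl
no-exit-no-entry false false _ _ = refl

-- One position k of Arcs, with p = u k, q = u (next k) and x = g (next k).
arc-step : ∀ p q {n x} → x < suc n →
           ⟦ p ⟧ * ⟦ q ⟧ * suc n + ⟦ q ⟧ * x + ⟦ p ∧ not q ⟧ * suc n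
             ≤ ⟦ p ⟧ * suc n + ⟦ p ⟧ * x + ⟦ not p ∧ q ⟧ * n
arc-step true  true  _   = ≤-refl
arc-step true  false _   = ≤-trans (m≤m+n _ _) (m≤m+n _ 0)
arc-step false true  x<N = ≤-trans (≤-reflexive (+-identityʳ _)) (+-monoˡ-≤ 0 (s≤s⁻¹ x<N))
arc-step false false _   = z≤n

arc-arith : ∀ {n C B v G₀ G₁ E r : ℕ} → 1 ≤ E →
            C * suc n + G₀ + E * suc n ≤ v * suc n + G₁ + E * n →
            suc n * B + G₁ ≡ v * r + G₀ →
            suc n * (C + B) < (suc n + r) * v
arc-arith {n} {C} {B} {v} {G₀} {G₁} {E} {r} 1≤E steps balance = +-cancelʳ-< (G₀ + G₁) _ _ (begin-strict
  suc n * (C + B) + (G₀ + G₁)          ≡⟨ regroup (suc n) C B G₀ G₁ ⟩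
  (C * suc n + G₀) + (suc n * B + G₁)  <⟨ +-mono-<-≤ inner< (≤-reflexive balance) ⟩
  (v * suc n + G₁) + (v * r + G₀)      ≡⟨ collect (suc n) r v G₀ G₁ ⟩
  (suc n + r) * v + (G₀ + G₁)          ∎)
  where
  open ≤-Reasoning
  regroup : ∀ N C B G₀ G₁ → N * (C + B) + (G₀ + G₁) ≡ (C * N + G₀) + (N * B + G₁)
  regroup = solve-∀
  collect : ∀ N r v G₀ G₁ → (v * N + G₁) + (v * r + G₀) ≡ (N + r) * v + (G₀ + G₁)
  collect = solve-∀
  inner< : C * suc n + G₀ < v * suc n + G₁
  inner< = +-cancelʳ-≤ (E * n) _ _ (begin
    suc (C * suc n + G₀) + E * n  ≡⟨ +-suc (C * suc n + G₀) (E * n) ⟨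
    C * suc n + G₀ + (1 + E * n)  ≤⟨ +-monoʳ-≤ (C * suc n + G₀) (+-monoˡ-≤ (E * n) 1≤E) ⟩
    C * suc n + G₀ + (E + E * n)  ≡⟨ cong (C * suc n + G₀ +_) (*-suc E n) ⟨
    C * suc n + G₀ + E * suc n    ≤⟨ steps ⟩
    v * suc n + G₁ + E * n        ∎)

-- b k marks position k of a cycle of length N. Summed along an arc of length ℓ, the balance
-- identity telescopes to N·(marks on the arc) < ℓr + N, since the potential g stays below N.
module Arcs {n : ℕ} (r : ℕ) (b g : Fin (suc n) → ℕ)
            (g<N : ∀ k → g k < suc n)
            (balance : ∀ k → suc n * b k + g (next k) ≡ r + g k) where

  private
    N : ℕ
    N = suc n

  ∑-balance : ∑ (allFin N) b ≡ r
  ∑-balance = *-cancelˡ-≡ (∑ (allFin N) b) r N (+-cancelʳ-≡ (∑ (allFin N) g) _ _ (begin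
    N * ∑ (allFin N) b + ∑ (allFin N) g                         ≡⟨ cong₂ _+_ (*-distribˡ-∑ N b (allFin N)) (sym (∑-next g)) ⟩
    ∑[ k ∈ allFin N ] (N * b k) + ∑[ k ∈ allFin N ] g (next k)  ≡⟨ ∑-distrib-+ (λ k → N * b k) (g ∘ next) (allFin N) ⟨
    ∑[ k ∈ allFin N ] (N * b k + g (next k))                    ≡⟨ ∑-cong (allFin N) balance ⟩
    ∑[ k ∈ allFin N ] (r + g k)                                 ≡⟨ ∑-distrib-+ (λ _ → r) g (allFin N) ⟩
    ∑[ k ∈ allFin N ] r + ∑ (allFin N) g                        ≡⟨ cong (_+ ∑ (allFin N) g) (∑-allFin-const N r) ⟩
    N * r + ∑ (allFin N) g                                      ∎))
    where open ≡-Reasoning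

  module _ (u : Fin N → Bool) where

    stay exit entry : Fin N → ℕ
    stay  k = ⟦ u k ⟧ * ⟦ u (next k) ⟧
    exit  k = ⟦ u k ∧ not (u (next k)) ⟧
    entry k = ⟦ not (u k) ∧ u (next k) ⟧

    size inner load exits entries G₀ G₁ : ℕ
    size    = ∑[ k ∈ allFin N ] ⟦ u k ⟧
    inner   = ∑ (allFin N) stay
    load    = ∑[ k ∈ allFin N ] (⟦ u k ⟧ * b k)
    exits   = ∑ (allFin N) exit
    entries = ∑ (allFin N) entry
    G₀      = ∑[ k ∈ allFin N ] (⟦ u k ⟧ * g k)
    G₁      = ∑[ k ∈ allFin N ] (⟦ u k ⟧ * g (next k))

    exits≡entries : exits ≡ entries
    exits≡entries = +-cancelˡ-≡ inner exits entries (begin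
      inner + exits                          ≡⟨ ∑-distrib-+ stay exit (allFin N) ⟨
      ∑[ k ∈ allFin N ] (stay k + exit k)    ≡⟨ ∑-cong (allFin N) (λ k → split-exit (u k) (u (next k))) ⟨
      ∑[ k ∈ allFin N ] ⟦ u k ⟧              ≡⟨ ∑-next (λ k → ⟦ u k ⟧) ⟨
      ∑[ k ∈ allFin N ] ⟦ u (next k) ⟧       ≡⟨ ∑-cong (allFin N) (λ k → split-entry (u k) (u (next k))) ⟩
      ∑[ k ∈ allFin N ] (stay k + entry k)   ≡⟨ ∑-distrib-+ stay entry (allFin N) ⟩
      inner + entries                        ∎)
      where open ≡-Reasoning

    exits-pos : ∀ {i j} → u i ≡ false → u j ≡ true → 1 ≤ exits
    exits-pos {i} {j} uᵢ uⱼ = n≢0⇒n>0 exits≢0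
      where
      exits≢0 : exits ≢ 0
      exits≢0 exits≡0 = contradiction (trans (sym uᵢ) (trans (constant i) (trans (sym (constant j)) uⱼ))) (λ ())
        where
        steady : ∀ k → u (next k) ≡ u k
        steady k = no-exit-no-entry (u k) (u (next k))
          (∑≡0⇒≡0 exit exits≡0 (∈-allFin k))
          (∑≡0⇒≡0 entry (trans (sym exits≡entries) exits≡0) (∈-allFin k))
        constant : ∀ k → u k ≡ u fzero
        constant = next-induction (λ k → u k ≡ u fzero) refl (λ k uₖ≡u₀ → trans (steady k) uₖ≡u₀)

    ∑-arc-step : inner * N + G₀ + exits * N ≤ size * N + G₁ + exits * n
    ∑-arc-step = begin
      inner * N + G₀ + exits * N
        ≡⟨ cong₂ _+_ (cong₂ _+_ (*-distribʳ-∑ N stay (allFin N)) (sym (∑-next (λ k → ⟦ u k ⟧ * g k))))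
                     (*-distribʳ-∑ N exit (allFin N)) ⟩
      ∑[ k ∈ allFin N ] (stay k * N) + ∑[ k ∈ allFin N ] (⟦ u (next k) ⟧ * g (next k)) + ∑[ k ∈ allFin N ] (exit k * N)
        ≡⟨ ∑-distrib-+₃ (λ k → stay k * N) (λ k → ⟦ u (next k) ⟧ * g (next k)) (λ k → exit k * N) (allFin N) ⟨
      ∑[ k ∈ allFin N ] (stay k * N + ⟦ u (next k) ⟧ * g (next k) + exit k * N)
        ≤⟨ ∑-mono-≤ (allFin N) (λ k → arc-step (u k) (u (next k)) (g<N (next k))) ⟩
      ∑[ k ∈ allFin N ] (⟦ u k ⟧ * N + ⟦ u k ⟧ * g (next k) + entry k * n)
        ≡⟨ ∑-distrib-+₃ (λ k → ⟦ u k ⟧ * N) (λ k → ⟦ u k ⟧ * g (next k)) (λ k → entry k * n) (allFin N) ⟩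
      ∑[ k ∈ allFin N ] (⟦ u k ⟧ * N) + G₁ + ∑[ k ∈ allFin N ] (entry k * n)
        ≡⟨ cong₂ _+_ (cong (_+ G₁) (*-distribʳ-∑ N (λ k → ⟦ u k ⟧) (allFin N))) (*-distribʳ-∑ n entry (allFin N)) ⟨
      size * N + G₁ + entries * n
        ≡⟨ cong (λ e → size * N + G₁ + e * n) exits≡entries ⟨
      size * N + G₁ + exits * n
        ∎
      where open ≤-Reasoning

    load-balance : N * load + G₁ ≡ size * r + G₀
    load-balance = begin
      N * load + G₁
        ≡⟨ cong (_+ G₁) (*-distribˡ-∑ N (λ k → ⟦ u k ⟧ * b k) (allFin N)) ⟩
      ∑[ k ∈ allFin N ] (N * (⟦ u k ⟧ * b k)) + G₁
        ≡⟨ ∑-distrib-+ (λ k → N * (⟦ u k ⟧ * b k)) (λ k → ⟦ u k ⟧ * g (next k)) (allFin N) ⟨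
      ∑[ k ∈ allFin N ] (N * (⟦ u k ⟧ * b k) + ⟦ u k ⟧ * g (next k))
        ≡⟨ ∑-cong (allFin N) (λ k → trans (factor N ⟦ u k ⟧ (b k) (g (next k))) (cong (⟦ u k ⟧ *_) (balance k))) ⟩
      ∑[ k ∈ allFin N ] (⟦ u k ⟧ * (r + g k))
        ≡⟨ ∑-cong (allFin N) (λ k → *-distribˡ-+ ⟦ u k ⟧ r (g k)) ⟩
      ∑[ k ∈ allFin N ] (⟦ u k ⟧ * r + ⟦ u k ⟧ * g k)
        ≡⟨ ∑-distrib-+ (λ k → ⟦ u k ⟧ * r) (λ k → ⟦ u k ⟧ * g k) (allFin N) ⟩
      ∑[ k ∈ allFin N ] (⟦ u k ⟧ * r) + G₀
        ≡⟨ cong (_+ G₀) (*-distribʳ-∑ r (λ k → ⟦ u k ⟧) (allFin N)) ⟨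
      size * r + G₀
        ∎
      where
      open ≡-Reasoning
      factor : ∀ N a b x → N * (a * b) + a * x ≡ a * (N * b + x)
      factor = solve-∀

    arc-discrepancy : ∀ {i j} → u i ≡ false → u j ≡ true → N * (inner + load) < (N + r) * size
    arc-discrepancy uᵢ uⱼ = arc-arith {n} {inner} {load} {size} {G₀} {G₁} {exits} {r} (exits-pos uᵢ uⱼ) ∑-arc-step load-balance

⟦⟧-mono : ∀ {p q} → (p ≡ true → q ≡ true) → ⟦ p ⟧ ≤ ⟦ q ⟧
⟦⟧-mono {false}         _   = z≤n
⟦⟧-mono {true}  {true}  _   = ≤-refl
⟦⟧-mono {true}  {false} p⇒q = contradiction (p⇒q refl) (λ ())

⟦⟧*[⟦⟧*]≡⟦∧⟧* : ∀ p q x → ⟦ q ⟧ * (⟦ p ⟧ * x) ≡ ⟦ p ∧ q ⟧ * x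
⟦⟧*[⟦⟧*]≡⟦∧⟧* true  true  x = *-identityˡ (1 * x)
⟦⟧*[⟦⟧*]≡⟦∧⟧* true  false x = refl
⟦⟧*[⟦⟧*]≡⟦∧⟧* false q     x = *-zeroʳ ⟦ q ⟧

does-≟-true : ∀ b → does (b Data.Bool.≟ true) ≡ b
does-≟-true true  = refl
does-≟-true false = refl

module _ {n : ℕ} where

  ∑² : (Fin n → Fin n → ℕ) → ℕ
  ∑² F = ∑[ a ∈ allFin n ] ∑[ b ∈ allFin n ] F a b

  ∑²-cong : {F G : Fin n → Fin n → ℕ} → (∀ a b → F a b ≡ G a b) → ∑² F ≡ ∑² G
  ∑²-cong F≗G = ∑-cong (allFin n) (λ a → ∑-cong (allFin n) (F≗G a))

  ∑²-mono-≤ : {F G : Fin n → Fin n → ℕ} → (∀ a b → F a b ≤ G a b) → ∑² F ≤ ∑² G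
  ∑²-mono-≤ F≤G = ∑-mono-≤ (allFin n) (λ a → ∑-mono-≤ (allFin n) (F≤G a))

  ∑²-mono-< : {F G : Fin n → Fin n → ℕ} → (∀ a b → F a b ≤ G a b) → ∀ {a b} → F a b < G a b → ∑² F < ∑² G
  ∑²-mono-< F≤G {a} {b} Fab<Gab =
    ∑-mono-< (allFin n) (∈-allFin a) (λ a → ∑-mono-≤ (allFin n) (F≤G a)) (∑-mono-< (allFin n) (∈-allFin b) (F≤G a) Fab<Gab)

  ∑²-distrib-+ : (F G : Fin n → Fin n → ℕ) → ∑² (λ a b → F a b + G a b) ≡ ∑² F + ∑² G
  ∑²-distrib-+ F G = trans (∑-cong (allFin n) (λ a → ∑-distrib-+ (F a) (G a) (allFin n))) (∑-distrib-+ _ _ (allFin n))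

  *-distribˡ-∑² : (c : ℕ) (F : Fin n → Fin n → ℕ) → c * ∑² F ≡ ∑² (λ a b → c * F a b)
  *-distribˡ-∑² c F = trans (*-distribˡ-∑ c _ (allFin n)) (∑-cong (allFin n) (λ a → *-distribˡ-∑ c (F a) (allFin n)))

  ∑²-comm : (F : Fin n → Fin n → ℕ) → ∑² F ≡ ∑² (λ a b → F b a)
  ∑²-comm F = ∑-comm F (allFin n) (allFin n)

  ∑²-δ : (x y : Fin n) (F : Fin n → Fin n → ℕ) → ∑² (λ a b → ⟦ ⌊ x F.≟ a ⌋ ⟧ * (⟦ ⌊ y F.≟ b ⌋ ⟧ * F a b)) ≡ F x y
  ∑²-δ x y F = begin
    ∑² (λ a b → ⟦ ⌊ x F.≟ a ⌋ ⟧ * (⟦ ⌊ y F.≟ b ⌋ ⟧ * F a b))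
      ≡⟨ ∑-cong (allFin n) (λ a → *-distribˡ-∑ ⟦ ⌊ x F.≟ a ⌋ ⟧ _ (allFin n)) ⟨
    ∑[ a ∈ allFin n ] (⟦ ⌊ x F.≟ a ⌋ ⟧ * ∑[ b ∈ allFin n ] (⟦ ⌊ y F.≟ b ⌋ ⟧ * F a b))
      ≡⟨ ∑-δ x _ ⟩
    ∑[ b ∈ allFin n ] (⟦ ⌊ y F.≟ b ⌋ ⟧ * F x b)
      ≡⟨ ∑-δ y (F x) ⟩
    F x y
      ∎
    where open ≡-Reasoning

  ∑-allPairs : (f : Fin n × Fin n → ℕ) → ∑ (allPairs n) f ≡ ∑² (λ i j → f (i , j))
  ∑-allPairs f = trans (∑-concatMap _ f (allFin n)) (∑-cong (allFin n) (λ i → ∑-map (i ,_) f (allFin n)))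

  eCount-∑² : (E : Fin n → Fin n → Bool) → eCount E ≡ ∑² (λ i j → ⟦ (toℕ i <ᵇ toℕ j) ∧ E i j ⟧)
  eCount-∑² E = trans (countTrue-map _ (allPairs n)) (∑-allPairs _)

  module _ (E : Fin n → Fin n → Bool) (E-sym : ∀ i j → E i j ≡ E j i) (E-irr : ∀ i → E i i ≡ false) where

    private
      A : Fin n → Fin n → ℕ
      A i j = ⟦ (toℕ i <ᵇ toℕ j) ∧ E i j ⟧

    ordered-split : ∀ i j → ⟦ E i j ⟧ ≡ A i j + A j i
    ordered-split i j with <-cmp (toℕ i) (toℕ j)
    ... | tri< i<j _ i≯j rewrite <ᵇ-true i<j | <ᵇ-false i≯j = sym (+-identityʳ _)
    ... | tri> i≮j _ i>j rewrite <ᵇ-false i≮j | <ᵇ-true i>j = cong ⟦_⟧ (E-sym i j)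
    ... | tri≈ _ i≡j _   rewrite FinP.toℕ-injective {i = i} {j = j} i≡j | E-irr j | <ᵇ-false (n≮n (toℕ j)) = refl

    ∑²-symmetrize : (f : Fin n → Fin n → ℕ) → ∑² (λ i j → ⟦ E i j ⟧ * f i j) ≡ ∑² (λ i j → A i j * (f i j + f j i))
    ∑²-symmetrize f = begin
      ∑² (λ i j → ⟦ E i j ⟧ * f i j)                         ≡⟨ ∑²-cong (λ i j → trans (cong (_* f i j) (ordered-split i j)) (*-distribʳ-+ (f i j) (A i j) (A j i))) ⟩
      ∑² (λ i j → A i j * f i j + A j i * f i j)             ≡⟨ ∑²-distrib-+ _ _ ⟩
      ∑² (λ i j → A i j * f i j) + ∑² (λ i j → A j i * f i j) ≡⟨ cong (∑² (λ i j → A i j * f i j) +_) (∑²-comm _) ⟩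
      ∑² (λ i j → A i j * f i j) + ∑² (λ i j → A i j * f j i) ≡⟨ ∑²-distrib-+ _ _ ⟨
      ∑² (λ i j → A i j * f i j + A i j * f j i)             ≡⟨ ∑²-cong (λ i j → *-distribˡ-+ (A i j) (f i j) (f j i)) ⟨
      ∑² (λ i j → A i j * (f i j + f j i))                   ∎
      where open ≡-Reasoning

    ∑²-adj≡2*eCount : ∑² (λ i j → ⟦ E i j ⟧) ≡ 2 * eCount E
    ∑²-adj≡2*eCount = begin
      ∑² (λ i j → ⟦ E i j ⟧)             ≡⟨ ∑²-cong (λ i j → *-identityʳ ⟦ E i j ⟧) ⟨
      ∑² (λ i j → ⟦ E i j ⟧ * 1)         ≡⟨ ∑²-symmetrize (λ _ _ → 1) ⟩
      ∑² (λ i j → A i j * 2)             ≡⟨ ∑²-cong (λ i j → *-comm (A i j) 2) ⟩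
      ∑² (λ i j → 2 * A i j)             ≡⟨ *-distribˡ-∑² 2 A ⟨
      2 * ∑² A                           ≡⟨ cong (2 *_) (eCount-∑² E) ⟨
      2 * eCount E                       ∎
      where open ≡-Reasoning

Subgraph-irr : ∀ {n} {H : Graph n} (S : Subgraph H) → ∀ i → E S i i ≡ false
Subgraph-irr {H = H} S i with E S i i in eq
... | false = refl
... | true  = contradiction (trans (sym (E⊆H S i i eq)) (irr H i)) (λ ())

eCountS<eCount : ∀ {n} {H : Graph n} (S : Subgraph H) → ∀ {i j} → adj H i j ≡ true → E S i j ≡ false →
                 eCountS S < eCount (adj H)
eCountS<eCount {H = H} S {i} {j} Hij ESij = *-cancelˡ-< 2 _ _ (subst₂ _<_
  (∑²-adj≡2*eCount (E S) (Esymm S) (Subgraph-irr S)) (∑²-adj≡2*eCount (adj H) (symm H) (irr H))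
  (∑²-mono-< (λ a b → ⟦⟧-mono (E⊆H S a b)) (subst₂ (λ p q → ⟦ p ⟧ < ⟦ q ⟧) (sym ESij) (sym Hij) ≤-refl)))

module _ {n : ℕ} (G : Graph n) where

  ∑-edgesOf : (f : Fin n × Fin n → ℕ) →
              ∑ (edgesOf G) f ≡ ∑² (λ i j → ⟦ (toℕ i <ᵇ toℕ j) ∧ adj G i j ⟧ * f (i , j))
  ∑-edgesOf f = begin
    ∑ (edgesOf G) f
      ≡⟨ ∑-filter ordered? f (filter adjacent? (allPairs n)) ⟩
    ∑[ e ∈ filter adjacent? (allPairs n) ] (⟦ toℕ (proj₁ e) <ᵇ toℕ (proj₂ e) ⟧ * f e)
      ≡⟨ ∑-filter adjacent? (λ e → ⟦ toℕ (proj₁ e) <ᵇ toℕ (proj₂ e) ⟧ * f e) (allPairs n) ⟩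
    ∑[ e ∈ allPairs n ] (⟦ does (adjacent? e) ⟧ * (⟦ toℕ (proj₁ e) <ᵇ toℕ (proj₂ e) ⟧ * f e))
      ≡⟨ ∑-allPairs (λ e → ⟦ does (adjacent? e) ⟧ * (⟦ toℕ (proj₁ e) <ᵇ toℕ (proj₂ e) ⟧ * f e)) ⟩
    ∑² (λ i j → ⟦ does (adj G i j Data.Bool.≟ true) ⟧ * (⟦ toℕ i <ᵇ toℕ j ⟧ * f (i , j)))
      ≡⟨ ∑²-cong (λ i j → trans (cong (λ b → ⟦ b ⟧ * _) (does-≟-true (adj G i j))) (⟦⟧*[⟦⟧*]≡⟦∧⟧* (toℕ i <ᵇ toℕ j) (adj G i j) (f (i , j)))) ⟩
    ∑² (λ i j → ⟦ (toℕ i <ᵇ toℕ j) ∧ adj G i j ⟧ * f (i , j))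
      ∎
    where
    open ≡-Reasoning
    ordered? : (e : Fin n × Fin n) → Dec (toℕ (proj₁ e) < toℕ (proj₂ e))
    ordered? e = toℕ (proj₁ e) <? toℕ (proj₂ e)
    adjacent? : (e : Fin n × Fin n) → Dec (adj G (proj₁ e) (proj₂ e) ≡ true)
    adjacent? e = adj G (proj₁ e) (proj₂ e) Data.Bool.≟ true

  handshake : (w : Fin n → ℕ) → ∑[ e ∈ edgesOf G ] (w (proj₁ e) + w (proj₂ e)) ≡ ∑[ a ∈ allFin n ] (w a * degree G a)
  handshake w = begin
    ∑[ e ∈ edgesOf G ] (w (proj₁ e) + w (proj₂ e))           ≡⟨ ∑-edgesOf _ ⟩
    ∑² (λ i j → ⟦ (toℕ i <ᵇ toℕ j) ∧ adj G i j ⟧ * (w i + w j)) ≡⟨ ∑²-symmetrize (adj G) (symm G) (irr G) (λ i _ → w i) ⟨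
    ∑² (λ i j → ⟦ adj G i j ⟧ * w i)                           ≡⟨ ∑-cong (allFin n) (λ i → trans (∑-cong (allFin n) (λ j → *-comm ⟦ adj G i j ⟧ (w i)))
                                                                                            (sym (*-distribˡ-∑ (w i) _ (allFin n)))) ⟩
    ∑[ i ∈ allFin n ] (w i * ∑[ j ∈ allFin n ] ⟦ adj G i j ⟧)  ≡⟨ ∑-cong (allFin n) (λ i → cong (w i *_) (countTrue-map (adj G i) (allFin n))) ⟨
    ∑[ i ∈ allFin n ] (w i * degree G i)                       ∎
    where open ≡-Reasoning

module _ {n : ℕ} where

  joins : Fin n × Fin n → Fin n → Fin n → Bool
  joins e a b = (⌊ proj₁ e F.≟ a ⌋ ∧ ⌊ proj₂ e F.≟ b ⌋) ∨ (⌊ proj₁ e F.≟ b ⌋ ∧ ⌊ proj₂ e F.≟ a ⌋)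

  mult-∑ : (L : Multigraph n) (a b : Fin n) → mult L a b ≡ ∑[ e ∈ L ] ⟦ joins e a b ⟧
  mult-∑ L a b = countTrue-map (λ e → joins e a b) L

  ⟦joins⟧ : ∀ {x y} a b → x ≢ y →
            ⟦ joins (x , y) a b ⟧ ≡ ⟦ ⌊ x F.≟ a ⌋ ⟧ * ⟦ ⌊ y F.≟ b ⌋ ⟧ + ⟦ ⌊ x F.≟ b ⌋ ⟧ * ⟦ ⌊ y F.≟ a ⌋ ⟧
  ⟦joins⟧ {x} {y} a b x≢y with x F.≟ a | y F.≟ a
  ... | yes refl | yes refl = contradiction refl x≢y
  ... | yes _    | no _     = first-only ⌊ y F.≟ b ⌋ ⌊ x F.≟ b ⌋
    where
    first-only : ∀ q p → ⟦ q ∨ (p ∧ false) ⟧ ≡ 1 * ⟦ q ⟧ + ⟦ p ⟧ * 0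
    first-only true  true  = refl
    first-only true  false = refl
    first-only false true  = refl
    first-only false false = refl
  ... | no _     | y≟a      = ⟦∧⟧ ⌊ x F.≟ b ⌋ ⌊ y≟a ⌋
    where
    ⟦∧⟧ : ∀ p s → ⟦ p ∧ s ⟧ ≡ ⟦ p ⟧ * ⟦ s ⟧
    ⟦∧⟧ true  true  = refl
    ⟦∧⟧ true  false = refl
    ⟦∧⟧ false s     = refl

  ∑²-joins : ∀ {x y} → x ≢ y → (f : Fin n → Fin n → ℕ) → ∑² (λ a b → ⟦ joins (x , y) a b ⟧ * f a b) ≡ f x y + f y x
  ∑²-joins {x} {y} x≢y f = begin
    ∑² (λ a b → ⟦ joins (x , y) a b ⟧ * f a b)
      ≡⟨ ∑²-cong (λ a b → trans (cong (_* f a b) (⟦joins⟧ a b x≢y)) (expand (X a) (Y b) (X b) (Y a) (f a b))) ⟩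
    ∑² (λ a b → X a * (Y b * f a b) + X b * (Y a * f a b))
      ≡⟨ ∑²-distrib-+ (λ a b → X a * (Y b * f a b)) (λ a b → X b * (Y a * f a b)) ⟩
    ∑² (λ a b → X a * (Y b * f a b)) + ∑² (λ a b → X b * (Y a * f a b))
      ≡⟨ cong₂ _+_ (∑²-δ x y f) (trans (∑²-comm (λ a b → X b * (Y a * f a b))) (∑²-δ x y (λ a b → f b a))) ⟩
    f x y + f y x
      ∎
    where
    open ≡-Reasoning
    X Y : Fin n → ℕ
    X a = ⟦ ⌊ x F.≟ a ⌋ ⟧
    Y b = ⟦ ⌊ y F.≟ b ⌋ ⟧
    expand : ∀ p q r s z → (p * q + r * s) * z ≡ p * (q * z) + r * (s * z)
    expand = solve-∀

  loopless : (L : Multigraph n) → (∀ a → mult L a a ≡ 0) → ∀ {e} → e ∈ L → proj₁ e ≢ proj₂ e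
  loopless L no-loops {x , _} e∈L refl = contradiction
    (∑≡0⇒≡0 (λ e → ⟦ joins e x x ⟧) (trans (sym (mult-∑ L x x)) (no-loops x)) e∈L) loop-counted
    where
    loop-counted : ⟦ joins (x , x) x x ⟧ ≢ 0
    loop-counted rewrite trans (isYes≗does (x F.≟ x)) (dec-true (x F.≟ x) refl) = λ ()

  ∑²-mult : (L : Multigraph n) → (∀ a → mult L a a ≡ 0) → (f : Fin n → Fin n → ℕ) →
            ∑² (λ a b → mult L a b * f a b) ≡ ∑[ e ∈ L ] (f (proj₁ e) (proj₂ e) + f (proj₂ e) (proj₁ e))
  ∑²-mult L no-loops f = begin
    ∑² (λ a b → mult L a b * f a b)
      ≡⟨ ∑²-cong (λ a b → trans (cong (_* f a b) (mult-∑ L a b)) (*-distribʳ-∑ (f a b) _ L)) ⟩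
    ∑² (λ a b → ∑[ e ∈ L ] (⟦ joins e a b ⟧ * f a b))
      ≡⟨ ∑-cong (allFin n) (λ a → ∑-comm _ (allFin n) L) ⟩
    ∑[ a ∈ allFin n ] ∑[ e ∈ L ] ∑[ b ∈ allFin n ] (⟦ joins e a b ⟧ * f a b)
      ≡⟨ ∑-comm _ (allFin n) L ⟩
    ∑[ e ∈ L ] ∑² (λ a b → ⟦ joins e a b ⟧ * f a b)
      ≡⟨ ∑-cong-∈ L (λ e∈L → ∑²-joins (loopless L no-loops e∈L) f) ⟩
    ∑[ e ∈ L ] (f (proj₁ e) (proj₂ e) + f (proj₂ e) (proj₁ e))
      ∎
    where open ≡-Reasoning

inside : ∀ {n} → (Fin n → Bool) → Fin n × Fin n → ℕ
inside W e = ⟦ W (proj₁ e) ⟧ * ⟦ W (proj₂ e) ⟧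

module SimpleSum {n : ℕ} (H : Graph n) (L : Multigraph n) (simple : ∀ a b → mult L a b ≡ ⟦ adj H a b ⟧) where

  ∑²-adj≡∑-edges : (f : Fin n → Fin n → ℕ) →
                   ∑² (λ a b → ⟦ adj H a b ⟧ * f a b) ≡ ∑[ e ∈ L ] (f (proj₁ e) (proj₂ e) + f (proj₂ e) (proj₁ e))
  ∑²-adj≡∑-edges f = trans (∑²-cong (λ a b → cong (_* f a b) (sym (simple a b))))
                           (∑²-mult L (λ a → trans (simple a a) (cong ⟦_⟧ (irr H a))) f)

  eCount≡∑1 : eCount (adj H) ≡ ∑[ e ∈ L ] 1
  eCount≡∑1 = *-cancelˡ-≡ _ _ 2 (begin
    2 * eCount (adj H)               ≡⟨ ∑²-adj≡2*eCount (adj H) (symm H) (irr H) ⟨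
    ∑² (λ a b → ⟦ adj H a b ⟧)       ≡⟨ ∑²-cong (λ a b → *-identityʳ ⟦ adj H a b ⟧) ⟨
    ∑² (λ a b → ⟦ adj H a b ⟧ * 1)   ≡⟨ ∑²-adj≡∑-edges (λ _ _ → 1) ⟩
    ∑[ e ∈ L ] 2                     ≡⟨ *-distribˡ-∑ 2 (λ _ → 1) L ⟨
    2 * ∑[ e ∈ L ] 1                 ∎)
    where open ≡-Reasoning

  eCountS≤∑-inside : (S : Subgraph H) → eCountS S ≤ ∑ L (inside (V S))
  eCountS≤∑-inside S = *-cancelˡ-≤ 2 (begin
    2 * eCountS S                                     ≡⟨ ∑²-adj≡2*eCount (E S) (Esymm S) (Subgraph-irr S) ⟨
    ∑² (λ a b → ⟦ E S a b ⟧)                          ≤⟨ ∑²-mono-≤ edge-inside ⟩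
    ∑² (λ a b → ⟦ adj H a b ⟧ * (⟦ W a ⟧ * ⟦ W b ⟧))  ≡⟨ ∑²-adj≡∑-edges (λ a b → ⟦ W a ⟧ * ⟦ W b ⟧) ⟩
    ∑[ e ∈ L ] (inside W e + ⟦ W (proj₂ e) ⟧ * ⟦ W (proj₁ e) ⟧)
      ≡⟨ ∑-cong L (λ e → cong (λ x → inside W e + x) (trans (*-comm ⟦ W (proj₂ e) ⟧ _) (sym (+-identityʳ _)))) ⟩
    ∑[ e ∈ L ] (2 * inside W e)                       ≡⟨ *-distribˡ-∑ 2 (inside W) L ⟨
    2 * ∑ L (inside W)                                ∎)
    where
    open ≤-Reasoning
    W : Fin n → Bool
    W = V S
    edge-inside : ∀ a b → ⟦ E S a b ⟧ ≤ ⟦ adj H a b ⟧ * (⟦ W a ⟧ * ⟦ W b ⟧)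
    edge-inside a b with E S a b in eq
    ... | false = z≤n
    ... | true rewrite E⊆H S a b eq | E⊆V S a b eq | E⊆V S b a (trans (Esymm S b a) eq) = ≤-refl

2*⟦⟧*⟦⟧≤ : ∀ p q → 2 * (⟦ p ⟧ * ⟦ q ⟧) ≤ ⟦ p ⟧ + ⟦ q ⟧
2*⟦⟧*⟦⟧≤ true  true  = ≤-refl
2*⟦⟧*⟦⟧≤ true  false = z≤n
2*⟦⟧*⟦⟧≤ false q     = z≤n

module _ {n d : ℕ} (G : Graph n) (regular : ∀ v → degree G v ≡ d) where

  regular-handshake : (w : Fin n → ℕ) → ∑[ e ∈ edgesOf G ] (w (proj₁ e) + w (proj₂ e)) ≡ ∑ (allFin n) w * d
  regular-handshake w = trans (handshake G w)
    (trans (∑-cong (allFin n) (λ a → cong (w a *_) (regular a))) (sym (*-distribʳ-∑ d w (allFin n))))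

  regular-edge-count : 2 * ∑[ e ∈ edgesOf G ] 1 ≡ n * d
  regular-edge-count = begin
    2 * ∑[ e ∈ edgesOf G ] 1         ≡⟨ *-distribˡ-∑ 2 (λ _ → 1) (edgesOf G) ⟩
    ∑[ e ∈ edgesOf G ] 2             ≡⟨ regular-handshake (λ _ → 1) ⟩
    ∑[ a ∈ allFin n ] 1 * d          ≡⟨ cong (_* d) (trans (∑-allFin-const n 1) (*-identityʳ n)) ⟩
    n * d                            ∎
    where open ≡-Reasoning

  regular-inside : (W : Fin n → Bool) → 2 * ∑ (edgesOf G) (inside W) ≤ ∑[ a ∈ allFin n ] ⟦ W a ⟧ * d
  regular-inside W = begin
    2 * ∑ (edgesOf G) (inside W)                           ≡⟨ *-distribˡ-∑ 2 (inside W) (edgesOf G) ⟩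
    ∑[ e ∈ edgesOf G ] (2 * inside W e)                    ≤⟨ ∑-mono-≤ (edgesOf G) (λ e → 2*⟦⟧*⟦⟧≤ (W (proj₁ e)) (W (proj₂ e))) ⟩
    ∑[ e ∈ edgesOf G ] (⟦ W (proj₁ e) ⟧ + ⟦ W (proj₂ e) ⟧)  ≡⟨ regular-handshake (λ a → ⟦ W a ⟧) ⟩
    ∑[ a ∈ allFin n ] ⟦ W a ⟧ * d                          ∎
    where open ≤-Reasoning

spanning-or-missing : ∀ {n} (W : Fin n → Bool) → (∀ i → W i ≡ true) ⊎ ∃[ i ] W i ≡ false
spanning-or-missing {n} W with FinP.all? (λ i → W i Data.Bool.≟ true)
... | yes spanning = inj₁ spanning
... | no ¬spanning with FinP.¬∀⟶∃¬ n _ (λ i → W i Data.Bool.≟ true) ¬spanning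
...   | i , Wᵢ≢true = inj₂ (i , ¬-not Wᵢ≢true)

spanning-sparser : ∀ {n} {H : Graph (suc n)} (S : Subgraph H) → Proper S → (∀ i → V S i ≡ true) →
                   eCountS S * suc n < eCount (adj H) * vCountS S
spanning-sparser S (inj₁ (i , Vᵢ≡false)) spanning = contradiction (trans (sym (spanning i)) Vᵢ≡false) (λ ())
spanning-sparser {n} {H} S (inj₂ (i , j , Hᵢⱼ , ¬Sᵢⱼ)) spanning =
  subst (λ v → eCountS S * suc n < eCount (adj H) * v) (sym vCountS≡N) (*-monoˡ-< (suc n) (eCountS<eCount S Hᵢⱼ ¬Sᵢⱼ))
  where
  vCountS≡N : vCountS S ≡ suc n
  vCountS≡N = trans (countTrue-map (V S) (allFin (suc n)))
    (trans (∑-cong (allFin (suc n)) (cong ⟦_⟧ ∘ spanning)) (trans (∑-allFin-const (suc n) 1) (*-identityʳ (suc n))))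

sparse-arith : ∀ {e a c v d N r ρ : ℕ} → e ≤ a + c → 2 * a ≤ v * d → N * c < (N + r) * v → 2 * ρ ≡ N * d →
               e * N < (ρ + (N + r)) * v
sparse-arith {e} {a} {c} {v} {d} {N} {r} {ρ} e≤a+c 2a≤vd Nc< 2ρ≡Nd = *-cancelˡ-< 2 _ _ (begin-strict
  2 * (e * N)                      ≤⟨ *-monoʳ-≤ 2 (*-monoˡ-≤ N e≤a+c) ⟩
  2 * ((a + c) * N)                ≡⟨ expand a c N ⟩
  2 * a * N + 2 * (N * c)          ≤⟨ +-monoˡ-≤ (2 * (N * c)) (*-monoˡ-≤ N 2a≤vd) ⟩
  v * d * N + 2 * (N * c)          <⟨ +-monoʳ-< (v * d * N) (*-monoʳ-< 2 Nc<) ⟩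
  v * d * N + 2 * ((N + r) * v)    ≡⟨ cong (_+ 2 * ((N + r) * v)) (trans (swap v d N) (cong (v *_) (sym 2ρ≡Nd))) ⟩
  v * (2 * ρ) + 2 * ((N + r) * v)  ≡⟨ collect v ρ N r ⟩
  2 * ((ρ + (N + r)) * v)          ∎)
  where
  open ≤-Reasoning
  expand : ∀ a c N → 2 * ((a + c) * N) ≡ 2 * a * N + 2 * (N * c)
  expand = solve-∀
  swap : ∀ v d N → v * d * N ≡ v * (N * d)
  swap = solve-∀
  collect : ∀ v ρ N r → v * (2 * ρ) + 2 * ((N + r) * v) ≡ 2 * ((ρ + (N + r)) * v)
  collect = solve-∀

bridge-inside≤ : ∀ c a b → ⟦ c ⟧ * (⟦ a ⟧ * ⟦ b ⟧) ≤ ⟦ a ⟧ * ⟦ c ⟧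
bridge-inside≤ false a     b     = z≤n
bridge-inside≤ true  false b     = z≤n
bridge-inside≤ true  true  true  = ≤-refl
bridge-inside≤ true  true  false = z≤n

module Decomposition {n : ℕ} (d r : ℕ) (r≤N : r ≤ suc n) (H Hr : Graph (suc n)) (σ : Permutation′ (suc n))
  (y : Fin (suc n) → Fin (suc n)) (regular : ∀ v → degree Hr v ≡ d)
  (simple : ∀ a b → mult (edgesOf Hr ++ cycleEdges σ ++ bridgeEdges r σ y) a b ≡ ⟦ adj H a b ⟧) where

  private
    N : ℕ
    N = suc n

  open SimpleSum H (edgesOf Hr ++ cycleEdges σ ++ bridgeEdges r σ y) simple
  open Arcs r (λ k → ⟦ inR r k ⟧) (offset r) (λ k → m%n<n (toℕ k * r) N) (inR-balance r r≤N)

  ∑-bridgeEdges : (f : Fin N × Fin N → ℕ) → ∑ (bridgeEdges r σ y) f ≡ ∑[ k ∈ allFin N ] (⟦ inR r k ⟧ * f (σ ⟨$⟩ʳ k , y k))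
  ∑-bridgeEdges f = trans (∑-map (λ k → σ ⟨$⟩ʳ k , y k) f (filter in-R? (allFin N)))
    (trans (∑-filter in-R? (λ k → f (σ ⟨$⟩ʳ k , y k)) (allFin N))
           (∑-cong (allFin N) (λ k → cong (λ b → ⟦ b ⟧ * f (σ ⟨$⟩ʳ k , y k)) (does-≟-true (inR r k)))))
    where
    in-R? : (k : Fin N) → Dec (inR r k ≡ true)
    in-R? k = inR r k Data.Bool.≟ true

  ∑-components : (f : Fin N × Fin N → ℕ) → ∑ (edgesOf Hr ++ cycleEdges σ ++ bridgeEdges r σ y) f
    ≡ ∑ (edgesOf Hr) f + (∑[ k ∈ allFin N ] f (σ ⟨$⟩ʳ k , σ ⟨$⟩ʳ next k) + ∑[ k ∈ allFin N ] (⟦ inR r k ⟧ * f (σ ⟨$⟩ʳ k , y k)))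
  ∑-components f = trans (∑-++ f (edgesOf Hr) _) (cong (∑ (edgesOf Hr) f +_) (trans (∑-++ f (cycleEdges σ) _)
    (cong₂ _+_ (∑-map (λ k → σ ⟨$⟩ʳ k , σ ⟨$⟩ʳ next k) f (allFin N)) (∑-bridgeEdges f))))

  eCount≡∑Hr+N+r : eCount (adj H) ≡ ∑[ e ∈ edgesOf Hr ] 1 + (N + r)
  eCount≡∑Hr+N+r = trans eCount≡∑1 (trans (∑-components (λ _ → 1)) (cong (∑[ e ∈ edgesOf Hr ] 1 +_)
    (cong₂ _+_ (trans (∑-allFin-const N 1) (*-identityʳ N)) (trans (∑-cong (allFin N) (λ k → *-identityʳ ⟦ inR r k ⟧)) ∑-balance))))

  missing-sparser : (S : Subgraph H) → ∀ {i} → V S i ≡ false → 1 ≤ vCountS S →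
                    eCountS S * N < eCount (adj H) * vCountS S
  missing-sparser S {i} Vᵢ≡false 1≤v = subst (λ m → eCountS S * N < m * vCountS S) (sym eCount≡∑Hr+N+r)
    (sparse-arith {a = ∑ (edgesOf Hr) (inside W)} {c = inner u + bridges} {ρ = ∑[ e ∈ edgesOf Hr ] 1} eCountS≤components Hr-inside arc-bound (regular-edge-count Hr regular))
    where
    W : Fin N → Bool
    W = V S
    u : Fin N → Bool
    u k = W (σ ⟨$⟩ʳ k)
    bridges : ℕ
    bridges = ∑[ k ∈ allFin N ] (⟦ inR r k ⟧ * inside W (σ ⟨$⟩ʳ k , y k))
    v≡size : vCountS S ≡ size u
    v≡size = trans (countTrue-map W (allFin N)) (sym (∑-permute (λ a → ⟦ W a ⟧) σ))
    eCountS≤components : eCountS S ≤ ∑ (edgesOf Hr) (inside W) + (inner u + bridges)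
    eCountS≤components = ≤-trans (eCountS≤∑-inside S) (≤-reflexive (∑-components (inside W)))
    Hr-inside : 2 * ∑ (edgesOf Hr) (inside W) ≤ vCountS S * d
    Hr-inside = subst (λ v → 2 * ∑ (edgesOf Hr) (inside W) ≤ v * d) (sym (countTrue-map W (allFin N))) (regular-inside Hr regular W)
    bridges≤load : bridges ≤ load u
    bridges≤load = ∑-mono-≤ (allFin N) (λ k → bridge-inside≤ (inR r k) (u k) (W (y k)))
    u-true : ∃[ j ] u j ≡ true
    u-true = 1≤∑⟦⟧⇒∃ u (allFin N) (subst (1 ≤_) v≡size 1≤v)
    arc-bound : N * (inner u + bridges) < (N + r) * vCountS S
    arc-bound = ≤-<-trans (*-monoʳ-≤ N (+-monoʳ-≤ (inner u) bridges≤load))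
      (subst (λ v → N * (inner u + load u) < (N + r) * v) (sym v≡size)
        (arc-discrepancy u {i = σ ⟨$⟩ˡ i} (trans (cong W (inverseʳ σ)) Vᵢ≡false) (proj₂ u-true)))

  strictly-balanced : StrictlyBalanced H
  strictly-balanced S proper 1≤v with spanning-or-missing (V S)
  ... | inj₁ spanning      = spanning-sparser S proper spanning
  ... | inj₂ (i , Vᵢ≡false) = missing-sparser S Vᵢ≡false 1≤v

proposition1 : (h m q r : ℕ) → 2 * h + 2 ≤ m → m ≡ q * h + r → r < h →
    (H : Graph (2 * h)) → InSupport h q r H → StrictlyBalanced H
proposition1 zero    m q r _ _ () H _
proposition1 (suc h) m q r _ _ r<h H (Hr , σ , y , regular , _ , simple) =
  Decomposition.strictly-balanced (q ∸ 2) r r≤N H Hr σ y regular simple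
  where
  r≤N : r ≤ 2 * suc h
  r≤N = ≤-trans (<⇒≤ r<h) (m≤m+n (suc h) (suc h + 0))
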